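{- For all integers $r,K\ge 2$ there exists $n_0=n_0(r,K)$ such that the following holds for all $n\ge n_0$ and $\delta\in(0,1/4]$. Let $G$ be an $r$-edge-coloured bipartite graph on vertex classes $A$ and $B$, where $|B|=n$ and $|A|\le r^{Kr}$, such that $\deg(v,B)\ge(1-\delta)n$ for each $v\in A$. Then $G$ contains a collection of at most \[ r\left\lceil\frac{3Kr\log r}{\log(1/\delta)}\right\rceil \] pairwise vertex-disjoint monochromatic cycles covering $A$.
   Context: An $r$-edge-coloured graph is a simple graph with an edge colouring by $[r]$; $\deg(v,B)$ is the number of neighbours of $v$ in $B$. A monochromatic cycle is a cycle all of whose edges have one colour; the empty graph, a single vertex and a single edge count as (degenerate) cycles. Logarithms are natural. -}

module Defs where

open import Data.Nat using (ℕ; suc; _+_; _*_; _^_; _≤_; _<_)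
open import Data.Fin using (Fin; toℕ; fromℕ<)
open import Data.Fin.Properties using ()
open import Data.Nat.DivMod using (_%_; m%n<n)
open import Data.Maybe using (Maybe; just; is-just)
open import Data.Bool using (if_then_else_)
open import Data.List using (List; map; allFin)
open import Data.Nat.ListAction using (sum)
open import Data.Sum using (_⊎_; inj₁; inj₂)
open import Data.Product using (Σ; ∃; _×_; _,_)
open import Data.Empty using (⊥)
open import Function.Definitions using (Injective)
open import Relation.Binary.PropositionalEquality using (_≡_)

-- An r-edge-coloured bipartite graph with vertex classes A = Fin a and
-- B = Fin n: for each pair (x , y) ∈ A × B, either no edge (nothing) or an
-- edge of colour (just i), i ∈ Fin r.
BipColGraph : ℕ → ℕ → ℕ → Set
BipColGraph r a n = Fin a → Fin n → Maybe (Fin r)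

Vertex : ℕ → ℕ → Set
Vertex a n = Fin a ⊎ Fin n

degB : ∀ {r a n} → BipColGraph r a n → Fin a → ℕ
degB {n = n} G v = sum (map (λ y → if is-just (G v y) then 1 else 0) (allFin n))

sucMod : ∀ {k} → Fin k → Fin k
sucMod {suc k} i = fromℕ< (m%n<n (suc (toℕ i)) (suc k))

-- Since G is bipartite,
-- a cycle alternates x₀ y₀ x₁ y₁ … x_{k-1} y_{k-1} (x's in A, y's in B,
-- all distinct) with edges xᵢyᵢ and yᵢx_{i+1 mod k}, all of colour col.
-- k = 0 is the empty graph, k = 1 is a single edge x₀y₀, k ≥ 2 a genuine
-- cycle of length 2k.  The single-vertex degenerate cycles are separate
-- constructors.
data MonoCycle {r a n : ℕ} (G : BipColGraph r a n) : Set where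
  vertexA : Fin a → MonoCycle G
  vertexB : Fin n → MonoCycle G
  cyc     : (k : ℕ) (col : Fin r) (xs : Fin k → Fin a) (ys : Fin k → Fin n) →
            Injective _≡_ _≡_ xs → Injective _≡_ _≡_ ys →
            (∀ i → G (xs i) (ys i) ≡ just col) →
            (∀ i → G (xs (sucMod i)) (ys i) ≡ just col) →
            MonoCycle G

_∈C_ : ∀ {r a n} {G : BipColGraph r a n} → Vertex a n → MonoCycle G → Set
v ∈C vertexA x = v ≡ inj₁ x
v ∈C vertexB y = v ≡ inj₂ y
v ∈C cyc k col xs ys _ _ _ _ = (Σ (Fin k) λ i → v ≡ inj₁ (xs i)) ⊎ (Σ (Fin k) λ i → v ≡ inj₂ (ys i))

Disjoint : ∀ {r a n} {G : BipColGraph r a n} → MonoCycle G → MonoCycle G → Set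
Disjoint {a = a} {n = n} C D = (v : Vertex a n) → v ∈C C → v ∈C D → ⊥

-- Cover A in rounds.  In a round with uncovered set A' and used vertices U ⊆ B,
-- take vertices Y ⊆ B ∖ U with |Y| ≥ |A'|, each missing at most 2δ|A'| vertices
-- of A' (by double counting and Markov at least half of B qualifies), such that
-- every x ∈ A' sees all of Y in one colour or not at all (iterated pigeonhole,
-- which is where n ≥ n₀ is needed).  Fix y₀ ∈ Y and match A' with Y: the pairs
-- (x , y) with xy₀ of colour c span a colour-c cycle x₁y₁x₂y₂…, since x sees
-- every vertex of Y in the colour of xy₀.  These r cycles cover A' except for
-- the at most 2δ|A'| non-neighbours of y₀.  As 2δ ≤ 1/2, at most 2|A| vertices
-- of B are ever used, and as |A|(2δ)ᵏ < 1 whenever δᵏ ≤ r^(-3Kr), nothing is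
-- left after k rounds.
module Submission where

open import Data.Bool using (if_then_else_)
open import Data.Empty using (⊥-elim)
open import Data.Fin using (Fin)
import Data.Fin as Fin
open import Data.List using (List; []; _∷_; _++_; length; map; filter; zip; lookup; tabulate; allFin)
open import Data.List.Properties using (length-++; length-map; length-tabulate; length-zipWith; filter-all)
open import Data.List.Membership.Propositional using (_∈_; _∉_)
open import Data.List.Membership.Propositional.Properties
  using (∈-filter⁻; ∈-filter⁺; ∈-∃++; ∈-++⁻; ∈-++⁺ˡ; ∈-++⁺ʳ; ∈-lookup; ∈-map⁺; ∈-allFin)
open import Data.List.Relation.Binary.Sublist.Propositional using (_⊆_; []; _∷_; _∷ʳ_; ⊆-refl; ⊆-trans)
open import Data.List.Relation.Binary.Sublist.Propositional.Properties
  using (filter-⊆; filter⁺; length-mono-≤; All-resp-⊆; Any-resp-⊆)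
open import Data.List.Relation.Unary.All as All using (All; []; _∷_)
import Data.List.Relation.Unary.All.Properties as AllP
open import Data.List.Relation.Unary.AllPairs as AllPairs using (AllPairs; []; _∷_)
import Data.List.Relation.Unary.AllPairs.Properties as APP
open import Data.List.Relation.Unary.Any as Any using (Any; here; there; index)
import Data.List.Relation.Unary.Any.Properties as AnyP
open import Data.List.Relation.Unary.Unique.Propositional using (Unique)
import Data.List.Relation.Unary.Unique.Propositional.Properties as UP
open import Data.Maybe using (Maybe; just; nothing; is-just)
open import Data.Maybe.Properties using (≡-dec; just-injective)
open import Data.Nat using (ℕ; zero; suc; _+_; _*_; _^_; _∸_; _≤_; _<_; z≤n; s≤s; _≤?_; NonZero; >-nonZero)
open import Data.Nat.ListAction using (sum)
open import Data.Nat.Properties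
open import Algebra.Properties.CommutativeSemigroup +-commutativeSemigroup using (x∙yz≈y∙xz)
open import Data.Nat.Tactic.RingSolver using (solve-∀)
open import Data.Product using (Σ; ∃; _×_; _,_; proj₁; proj₂)
open import Data.Sum using (_⊎_; inj₁; inj₂; [_,_]′)
open import Data.Sum.Properties using (inj₁-injective; inj₂-injective)
open import Function using (_∘_; id; case_of_)
open import Level using (0ℓ)
open import Relation.Binary.Definitions using (DecidableEquality)
open import Relation.Binary.PropositionalEquality
open import Relation.Nullary using (Dec; yes; no; ¬_)
open import Relation.Unary using (Pred; Decidable)
open import Relation.Unary.Properties using (∁?)

open import Defs

^-distribʳ-* : ∀ m n k → (m * n) ^ k ≡ m ^ k * n ^ k
^-distribʳ-* m n zero    = refl
^-distribʳ-* m n (suc k) = trans (cong (m * n *_) (^-distribʳ-* m n k)) ([m*n]*[o*p]≡[m*o]*[n*p] m n _ _)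

m^[3*e]≡m^e*m^e*m^e : ∀ m e → m ^ (3 * e) ≡ m ^ e * m ^ e * m ^ e
m^[3*e]≡m^e*m^e*m^e m e = begin
  m ^ (3 * e)                 ≡⟨ cong (m ^_) (*-comm 3 e) ⟩
  m ^ (e * 3)                 ≡⟨ ^-*-assoc m e 3 ⟨
  m ^ e * (m ^ e * (m ^ e * 1)) ≡⟨ cube (m ^ e) ⟩
  m ^ e * m ^ e * m ^ e       ∎
  where
  open ≡-Reasoning
  cube : ∀ x → x * (x * (x * 1)) ≡ x * x * x
  cube = solve-∀

q*l≤2p*s⇒2*l≤s : ∀ {p q l s} → 1 ≤ p → 4 * p ≤ q → q * l ≤ 2 * p * s → 2 * l ≤ s
q*l≤2p*s⇒2*l≤s {p} {q} {l} {s} 1≤p 4p≤q q*l≤2ps = *-cancelˡ-≤ (2 * p) (begin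
  2 * p * (2 * l)   ≡⟨ reorder p l ⟩
  4 * p * l         ≤⟨ *-monoˡ-≤ l 4p≤q ⟩
  q * l             ≤⟨ q*l≤2ps ⟩
  2 * p * s         ∎)
  where
  open ≤-Reasoning
  instance
    2p≢0 : NonZero (2 * p)
    2p≢0 = >-nonZero (≤-trans 1≤p (m≤n*m p 2))
  reorder : ∀ p l → 2 * p * (2 * l) ≡ 4 * p * l
  reorder = solve-∀

q*l≤d*s⇒l*x<z : ∀ {q l d s x z} → q * l ≤ d * s → s * (d * x) < q * z → l * x < z
q*l≤d*s⇒l*x<z {q} {l} {d} {s} {x} {z} q*l≤d*s s*d*x<q*z = *-cancelˡ-< q (l * x) z (begin-strict
  q * (l * x)   ≡⟨ *-assoc q l x ⟨
  q * l * x     ≤⟨ *-monoˡ-≤ x q*l≤d*s ⟩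
  d * s * x     ≡⟨ reorder d s x ⟩
  s * (d * x)   <⟨ s*d*x<q*z ⟩
  q * z         ∎)
  where
  open ≤-Reasoning
  reorder : ∀ d s x → d * s * x ≡ s * (d * x)
  reorder = solve-∀

-- If 2ᵏ ≤ M the factor 2ᵏ is absorbed by M³pᵏ ≤ qᵏ, otherwise M is absorbed by (4p)ᵏ ≤ qᵏ.
a*[2p]^k<q^k : ∀ {M a p q k} → 2 ≤ M → a ≤ M → 1 ≤ p → 4 * p ≤ q →
  M * M * M * p ^ k ≤ q ^ k → a * (2 * p) ^ k < q ^ k
a*[2p]^k<q^k {M} {a} {p} {q} {k} 2≤M a≤M 1≤p 4p≤q M³pᵏ≤qᵏ with 2 ^ k ≤? M
... | yes 2ᵏ≤M = begin-strict
  a * (2 * p) ^ k        ≡⟨ cong (a *_) (^-distribʳ-* 2 p k) ⟩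
  a * (2 ^ k * p ^ k)    ≤⟨ *-mono-≤ a≤M (*-monoˡ-≤ (p ^ k) 2ᵏ≤M) ⟩
  M * (M * p ^ k)        ≡⟨ *-assoc M M (p ^ k) ⟨
  M * M * p ^ k          <⟨ m<m*n (M * M * p ^ k) M 2≤M ⟩
  M * M * p ^ k * M      ≡⟨ reorder M (p ^ k) ⟩
  M * M * M * p ^ k      ≤⟨ M³pᵏ≤qᵏ ⟩
  q ^ k                  ∎
  where
  open ≤-Reasoning
  instance
    M*M*pᵏ≢0 : NonZero (M * M * p ^ k)
    M*M*pᵏ≢0 = >-nonZero (*-mono-≤ (*-mono-≤ (<⇒≤ 2≤M) (<⇒≤ 2≤M)) (m^n>0 p {{>-nonZero 1≤p}} k))
  reorder : ∀ M P → M * M * P * M ≡ M * M * M * P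
  reorder = solve-∀
... | no 2ᵏ≰M = begin-strict
  a * (2 * p) ^ k        ≤⟨ *-monoˡ-≤ ((2 * p) ^ k) a≤M ⟩
  M * (2 * p) ^ k        <⟨ *-monoˡ-< ((2 * p) ^ k) (≰⇒> 2ᵏ≰M) ⟩
  2 ^ k * (2 * p) ^ k    ≡⟨ cong (2 ^ k *_) (^-distribʳ-* 2 p k) ⟩
  2 ^ k * (2 ^ k * p ^ k) ≡⟨ *-assoc (2 ^ k) (2 ^ k) (p ^ k) ⟨
  2 ^ k * 2 ^ k * p ^ k  ≡⟨ cong (_* p ^ k) (^-distribʳ-* 2 2 k) ⟨
  4 ^ k * p ^ k          ≡⟨ ^-distribʳ-* 4 p k ⟨
  (4 * p) ^ k            ≤⟨ ^-monoˡ-≤ k 4p≤q ⟩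
  q ^ k                  ∎
  where
  open ≤-Reasoning
  instance
    [2p]ᵏ≢0 : NonZero ((2 * p) ^ k)
    [2p]ᵏ≢0 = m^n≢0 (2 * p) k {{>-nonZero (≤-trans 1≤p (m≤n*m p 2))}}

m+n≡o⇒2n≤o⇒o≤2m : ∀ m n {o} → m + n ≡ o → 2 * n ≤ o → o ≤ 2 * m
m+n≡o⇒2n≤o⇒o≤2m m n refl 2n≤o = begin
  m + n        ≤⟨ +-monoʳ-≤ m n≤m ⟩
  m + m        ≡⟨ cong (m +_) (+-identityʳ m) ⟨
  2 * m        ∎
  where
  open ≤-Reasoning
  n≤m : n ≤ m
  n≤m = +-cancelʳ-≤ n n m (subst (_≤ m + n) (cong (n +_) (+-identityʳ n)) 2n≤o)

module _ {A : Set} {P : Pred A 0ℓ} (P? : Decidable P) where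

  length-filter-∁ : ∀ xs → length (filter P? xs) + length (filter (∁? P?) xs) ≡ length xs
  length-filter-∁ [] = refl
  length-filter-∁ (x ∷ xs) with P? x
  ... | yes _ = cong suc (length-filter-∁ xs)
  ... | no _  = trans (+-suc _ _) (cong suc (length-filter-∁ xs))

  markov : (h : A → ℕ) (c t : ℕ) → (∀ {x} → P x → t ≤ c * h x) →
    ∀ xs → t * length (filter P? xs) ≤ c * sum (map h xs)
  markov h c t big [] = ≤-reflexive (trans (*-zeroʳ t) (sym (*-zeroʳ c)))
  markov h c t big (x ∷ xs) with P? x
  ... | no _   = ≤-trans (markov h c t big xs) (*-monoʳ-≤ c (m≤n+m _ (h x)))
  ... | yes px = begin
    t * suc (length (filter P? xs))          ≡⟨ *-suc t _ ⟩
    t + t * length (filter P? xs)            ≤⟨ +-mono-≤ (big px) (markov h c t big xs) ⟩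
    c * h x + c * sum (map h xs)             ≡⟨ *-distribˡ-+ c (h x) _ ⟨
    c * sum (map h (x ∷ xs))                 ∎
    where open ≤-Reasoning

sum-map-≤ : {A : Set} (h : A → ℕ) (c b : ℕ) (xs : List A) →
  (∀ {x} → x ∈ xs → c * h x ≤ b) → c * sum (map h xs) ≤ length xs * b
sum-map-≤ h c b [] _ = ≤-reflexive (*-zeroʳ c)
sum-map-≤ h c b (x ∷ xs) bound = begin
  c * (h x + sum (map h xs))     ≡⟨ *-distribˡ-+ c (h x) _ ⟩
  c * h x + c * sum (map h xs)   ≤⟨ +-mono-≤ (bound (here refl)) (sum-map-≤ h c b xs (bound ∘ there)) ⟩
  b + length xs * b              ∎
  where open ≤-Reasoning

module _ {X Y : Set} {R : X → Y → Set} (R? : ∀ x y → Dec (R x y)) where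

  private
    column : List X → Y → ℕ
    column xs y = length (filter (λ x → R? x y) xs)

    sum-column-∷ : ∀ x xs ys →
      sum (map (column (x ∷ xs)) ys) ≡ length (filter (R? x) ys) + sum (map (column xs) ys)
    sum-column-∷ x xs [] = refl
    sum-column-∷ x xs (y ∷ ys) with R? x y
    ... | yes _ = cong suc (trans (cong (column xs y +_) (sum-column-∷ x xs ys))
                                  (x∙yz≈y∙xz (column xs y) (length (filter (R? x) ys)) _))
    ... | no _  = trans (cong (column xs y +_) (sum-column-∷ x xs ys))
                        (x∙yz≈y∙xz (column xs y) (length (filter (R? x) ys)) _)

  double-counting : ∀ xs ys →
    sum (map (λ y → length (filter (λ x → R? x y) xs)) ys) ≡ sum (map (λ x → length (filter (R? x) ys)) xs)
  double-counting [] ys = sum-zeros ys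
    where
    sum-zeros : ∀ ys → sum (map (λ _ → 0) ys) ≡ 0
    sum-zeros [] = refl
    sum-zeros (_ ∷ ys) = sum-zeros ys
  double-counting (x ∷ xs) ys =
    trans (sum-column-∷ x xs ys) (cong (length (filter (R? x) ys) +_) (double-counting xs ys))

unique-sublist : {A : Set} {xs ys : List A} → xs ⊆ ys → Unique ys → Unique xs
unique-sublist [] [] = []
unique-sublist (y ∷ʳ xs⊆ys) (_ ∷ uys) = unique-sublist xs⊆ys uys
unique-sublist (refl ∷ xs⊆ys) (y∉ys ∷ uys) = All-resp-⊆ xs⊆ys y∉ys ∷ unique-sublist xs⊆ys uys

unique⇒length≤ : {A : Set} {xs ys : List A} → Unique xs → (∀ {x} → x ∈ xs → x ∈ ys) →
  length xs ≤ length ys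
unique⇒length≤ {xs = []} _ _ = z≤n
unique⇒length≤ {xs = x ∷ xs} {ys} (x∉xs ∷ uxs) xs⊆ys with ∈-∃++ (xs⊆ys (here refl))
... | ys₁ , ys₂ , refl = begin
  suc (length xs)              ≤⟨ s≤s (unique⇒length≤ uxs xs⊆ys₁++ys₂) ⟩
  suc (length (ys₁ ++ ys₂))    ≡⟨ cong suc (length-++ ys₁) ⟩
  suc (length ys₁ + length ys₂) ≡⟨ +-suc (length ys₁) _ ⟨
  length ys₁ + suc (length ys₂) ≡⟨ length-++ ys₁ ⟨
  length (ys₁ ++ x ∷ ys₂)      ∎
  where
  open ≤-Reasoning
  xs⊆ys₁++ys₂ : ∀ {z} → z ∈ xs → z ∈ ys₁ ++ ys₂
  xs⊆ys₁++ys₂ z∈xs with ∈-++⁻ ys₁ (xs⊆ys (there z∈xs))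
  ... | inj₁ z∈ys₁         = ∈-++⁺ˡ z∈ys₁
  ... | inj₂ (here refl)   = ⊥-elim (All.lookup x∉xs z∈xs refl)
  ... | inj₂ (there z∈ys₂) = ∈-++⁺ʳ ys₁ z∈ys₂

AllPairs-∈ : {A : Set} {R : A → A → Set} {xs : List A} {x y : A} →
  AllPairs R xs → x ∈ xs → y ∈ xs → x ≡ y ⊎ R x y ⊎ R y x
AllPairs-∈ (_ ∷ _)     (here refl) (here refl) = inj₁ refl
AllPairs-∈ (Rx ∷ _)    (here refl) (there y∈) = inj₂ (inj₁ (All.lookup Rx y∈))
AllPairs-∈ (Rx ∷ _)    (there x∈) (here refl) = inj₂ (inj₂ (All.lookup Rx x∈))
AllPairs-∈ (_ ∷ pairs) (there x∈) (there y∈) = AllPairs-∈ pairs x∈ y∈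

lookup-injective : {A B : Set} (f : A → B) (xs : List A) → AllPairs (λ u v → f u ≢ f v) xs →
  ∀ {i j} → f (lookup xs i) ≡ f (lookup xs j) → i ≡ j
lookup-injective f (x ∷ xs) (_ ∷ _)      {Fin.zero}  {Fin.zero}  _ = refl
lookup-injective f (x ∷ xs) (fx≢ ∷ _)    {Fin.zero}  {Fin.suc j} e = ⊥-elim (All.lookup fx≢ (∈-lookup j) e)
lookup-injective f (x ∷ xs) (fx≢ ∷ _)    {Fin.suc i} {Fin.zero}  e = ⊥-elim (All.lookup fx≢ (∈-lookup i) (sym e))
lookup-injective f (x ∷ xs) (_ ∷ pairs)  {Fin.suc i} {Fin.suc j} e = cong Fin.suc (lookup-injective f xs pairs e)

module _ {X Y : Set} where

  Apart : X × Y → X × Y → Set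
  Apart u v = proj₁ u ≢ proj₁ v × proj₂ u ≢ proj₂ v

  ∈-zip⁻ : ∀ {xs : List X} {ys : List Y} {u} → u ∈ zip xs ys → proj₁ u ∈ xs × proj₂ u ∈ ys
  ∈-zip⁻ {x ∷ xs} {y ∷ ys} (here refl) = here refl , here refl
  ∈-zip⁻ {x ∷ xs} {y ∷ ys} (there u∈) = let (x∈ , y∈) = ∈-zip⁻ {xs} {ys} u∈ in there x∈ , there y∈

  ∈-zip⁺ : ∀ {xs : List X} {ys : List Y} {x} → length xs ≤ length ys → x ∈ xs → ∃ λ y → (x , y) ∈ zip xs ys
  ∈-zip⁺ {x ∷ xs} {y ∷ ys} _         (here refl) = y , here refl
  ∈-zip⁺ {x ∷ xs} {y ∷ ys} (s≤s len) (there x∈) = let (y' , u∈) = ∈-zip⁺ {xs} {ys} len x∈ in y' , there u∈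

  length-zip : ∀ {xs : List X} {ys : List Y} → length xs ≤ length ys → length (zip xs ys) ≡ length xs
  length-zip {xs} {ys} len = trans (length-zipWith _,_ xs ys) (m≤n⇒m⊓n≡m len)

  zip-apart : ∀ {xs : List X} {ys : List Y} → Unique xs → Unique ys → AllPairs Apart (zip xs ys)
  zip-apart {[]}     {_}      _ _ = []
  zip-apart {x ∷ xs} {[]}     _ _ = []
  zip-apart {x ∷ xs} {y ∷ ys} (x∉xs ∷ uxs) (y∉ys ∷ uys) =
    All.tabulate (λ u∈ → let (x'∈ , y'∈) = ∈-zip⁻ u∈ in All.lookup x∉xs x'∈ , All.lookup y∉ys y'∈)
    ∷ zip-apart uxs uys

∃∈ : {A : Set} {xs : List A} → 1 ≤ length xs → ∃ (_∈ xs)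
∃∈ {xs = x ∷ _} _ = x , here refl

module _ {A C : Set} (_≟_ : DecidableEquality C) (f : A → C) where

  fibre : C → List A → List A
  fibre c = filter (λ y → f y ≟ c)

  -- The factor is 2^|c₀ ∷ cs| rather than |c₀ ∷ cs| because the proof only ever halves.
  pigeonhole : (c₀ : C) (cs : List C) (ys : List A) → (∀ {y} → y ∈ ys → f y ∈ c₀ ∷ cs) →
    ∃ λ c → length ys ≤ 2 ^ length (c₀ ∷ cs) * length (fibre c ys)
  pigeonhole c₀ [] ys onto =
    c₀ , subst (λ zs → length ys ≤ 2 * length zs) (sym (filter-all (λ y → f y ≟ c₀) all-c₀)) (m≤n*m _ 2)
    where
    all-c₀ : All (λ y → f y ≡ c₀) ys
    all-c₀ = All.tabulate λ y∈ys → case onto y∈ys of λ where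
      (here fy≡c₀) → fy≡c₀
  pigeonhole c₀ (c₁ ∷ cs) ys onto = choose (length ys ≤? 2 * length rest)
    where
    open ≤-Reasoning
    N = 2 ^ length (c₁ ∷ cs)
    rest = filter (∁? (λ y → f y ≟ c₀)) ys
    split : length (fibre c₀ ys) + length rest ≡ length ys
    split = length-filter-∁ (λ y → f y ≟ c₀) ys
    onto-rest : ∀ {y} → y ∈ rest → f y ∈ c₁ ∷ cs
    onto-rest y∈rest with ∈-filter⁻ (∁? (λ y → f y ≟ c₀)) y∈rest
    ... | y∈ys , fy≢c₀ with onto y∈ys
    ...   | here fy≡c₀ = ⊥-elim (fy≢c₀ fy≡c₀)
    ...   | there fy∈cs = fy∈cs
    choose : Dec (length ys ≤ 2 * length rest) → ∃ λ c → length ys ≤ 2 * N * length (fibre c ys)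
    choose (no ¬small) = c₀ , (begin
      length ys                     ≤⟨ m+n≡o⇒2n≤o⇒o≤2m F₀ (length rest) split (<⇒≤ (≰⇒> ¬small)) ⟩
      2 * F₀                        ≤⟨ *-monoˡ-≤ F₀ (*-monoʳ-≤ 2 (m^n>0 2 (length (c₁ ∷ cs)))) ⟩
      2 * N * F₀                    ∎)
      where F₀ = length (fibre c₀ ys)
    choose (yes small) = let (c , rest≤) = pigeonhole c₁ cs rest onto-rest in c , (begin
      length ys                     ≤⟨ small ⟩
      2 * length rest               ≤⟨ *-monoʳ-≤ 2 rest≤ ⟩
      2 * (N * length (fibre c rest)) ≡⟨ *-assoc 2 N _ ⟨
      2 * N * length (fibre c rest) ≤⟨ *-monoʳ-≤ (2 * N) (length-mono-≤ (fibre-mono c)) ⟩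
      2 * N * length (fibre c ys)   ∎)
      where
      fibre-mono : ∀ c → fibre c rest ⊆ fibre c ys
      fibre-mono c = filter⁺ _ _ (λ { refl fy≡c → fy≡c }) (filter-⊆ _ ys)

ConstantOn : {Y C : Set} → (Y → C) → List Y → Set
ConstantOn g zs = ∀ {y y'} → y ∈ zs → y' ∈ zs → g y ≡ g y'

module _ {X Y C : Set} (_≟_ : DecidableEquality C) (c₀ : C) (cs : List C) (enum : ∀ c → c ∈ c₀ ∷ cs)
         (f : X → Y → C) where

  homogeneous-sublist : (xs : List X) (ys : List Y) → ∃ λ zs →
    zs ⊆ ys ×
    length ys ≤ (2 ^ length (c₀ ∷ cs)) ^ length xs * length zs ×
    All (λ x → ConstantOn (f x) zs) xs
  homogeneous-sublist [] ys = ys , ⊆-refl , ≤-reflexive (sym (+-identityʳ _)) , []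
  homogeneous-sublist (x ∷ xs) ys = zs , ⊆-trans zs⊆ (filter-⊆ _ ys) , ys≤ , constant ∷ constants
    where
    open ≤-Reasoning
    N = 2 ^ length (c₀ ∷ cs)
    biggest = pigeonhole _≟_ (f x) c₀ cs ys (λ {y} _ → enum (f x y))
    c = proj₁ biggest
    rec = homogeneous-sublist xs (fibre _≟_ (f x) c ys)
    zs = proj₁ rec
    zs⊆ = proj₁ (proj₂ rec)
    fibre≤ = proj₁ (proj₂ (proj₂ rec))
    constants = proj₂ (proj₂ (proj₂ rec))
    ys≤ : length ys ≤ N ^ length (x ∷ xs) * length zs
    ys≤ = begin
      length ys                                   ≤⟨ proj₂ biggest ⟩
      N * length (fibre _≟_ (f x) c ys)           ≤⟨ *-monoʳ-≤ N fibre≤ ⟩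
      N * (N ^ length xs * length zs)             ≡⟨ *-assoc N _ _ ⟨
      N ^ length (x ∷ xs) * length zs             ∎
    fibre-value : ∀ {y} → y ∈ zs → f x y ≡ c
    fibre-value y∈zs = proj₂ (∈-filter⁻ (λ y → f x y ≟ c) {xs = ys} (Any-resp-⊆ zs⊆ y∈zs))
    constant : ConstantOn (f x) zs
    constant y∈zs y'∈zs = trans (fibre-value y∈zs) (sym (fibre-value y'∈zs))

module Bicliques {r a n : ℕ} (G : BipColGraph r a n) where

  record MonoBiclique : Set where
    field
      colour   : Fin r
      pairs    : List (Fin a × Fin n)
      apart    : AllPairs Apart pairs
      complete : ∀ {u v} → u ∈ pairs → v ∈ pairs → G (proj₁ u) (proj₂ v) ≡ just colour

  open MonoBiclique public

  toCycle : MonoBiclique → MonoCycle G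
  toCycle S = cyc (length (pairs S)) (colour S) (proj₁ ∘ lookup (pairs S)) (proj₂ ∘ lookup (pairs S))
    (lookup-injective proj₁ (pairs S) (AllPairs.map proj₁ (apart S)))
    (lookup-injective proj₂ (pairs S) (AllPairs.map proj₂ (apart S)))
    (λ i → complete S (∈-lookup i) (∈-lookup i))
    (λ i → complete S (∈-lookup (sucMod i)) (∈-lookup i))

  Separated : MonoBiclique → MonoBiclique → Set
  Separated S T = ∀ {u v} → u ∈ pairs S → v ∈ pairs T → Apart u v

  separated⇒disjoint : ∀ {S T} → Separated S T → Disjoint (toCycle S) (toCycle T)
  separated⇒disjoint S∥T _ (inj₁ (i , refl)) (inj₁ (j , e)) =
    proj₁ (S∥T (∈-lookup i) (∈-lookup j)) (inj₁-injective e)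
  separated⇒disjoint S∥T _ (inj₁ (i , refl)) (inj₂ (j , ()))
  separated⇒disjoint S∥T _ (inj₂ (i , refl)) (inj₁ (j , ()))
  separated⇒disjoint S∥T _ (inj₂ (i , refl)) (inj₂ (j , e)) =
    proj₂ (S∥T (∈-lookup i) (∈-lookup j)) (inj₂-injective e)

  Covers : Fin a → MonoBiclique → Set
  Covers x S = ∃ λ y → (x , y) ∈ pairs S

  covers⇒∈C : ∀ {x S} → Covers x S → inj₁ x ∈C toCycle S
  covers⇒∈C (_ , xy∈) = inj₁ (index xy∈ , cong (inj₁ ∘ proj₁) (AnyP.lookup-index xy∈))

  FitsIn : List (Fin a) → List (Fin n) → MonoBiclique → Set
  FitsIn xs U S = ∀ {u} → u ∈ pairs S → proj₁ u ∈ xs × proj₂ u ∉ U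

  record Cover (j : ℕ) (xs : List (Fin a)) (U : List (Fin n)) : Set where
    field
      bicliques : List MonoBiclique
      few       : length bicliques ≤ r * j
      separated : AllPairs Separated bicliques
      fit       : All (FitsIn xs U) bicliques
      covers    : ∀ {x} → x ∈ xs → Any (Covers x) bicliques

  cover⇒cycles : ∀ {j xs U} → Cover j xs U → Σ (List (MonoCycle G)) λ cs →
    length cs ≤ r * j × AllPairs Disjoint cs × (∀ {x} → x ∈ xs → Any (λ C → inj₁ x ∈C C) cs)
  cover⇒cycles {j} C = map toCycle bicliques
                     , subst (_≤ r * j) (sym (length-map toCycle bicliques)) few
                     , APP.map⁺ (AllPairs.map (λ {S} {T} → separated⇒disjoint {S} {T}) separated)
                     , λ x∈xs → AnyP.map⁺ (Any.map (λ {S} → covers⇒∈C {S = S}) (covers x∈xs))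
    where open Cover C

nothing? : {A : Set} (m : Maybe A) → Dec (m ≡ nothing)
nothing? nothing  = yes refl
nothing? (just _) = no λ ()

edgeStates : (r : ℕ) → List (Maybe (Fin r))
edgeStates r = nothing ∷ map just (allFin r)

∈-edgeStates : ∀ {r} (e : Maybe (Fin r)) → e ∈ edgeStates r
∈-edgeStates nothing  = here refl
∈-edgeStates (just c) = there (∈-map⁺ just (∈-allFin c))

refinementFactor : ℕ → ℕ
refinementFactor r = 2 ^ length (edgeStates r)

-- Large enough that, after discarding the bad half of B and at most 2M used vertices,
-- refining for at most M vertices of A still leaves M vertices.
threshold : ℕ → ℕ → ℕ
threshold r M = 2 * (refinementFactor r ^ M * M + 2 * M)

module Covering {r a n : ℕ} (G : BipColGraph r a n) (p q : ℕ) (1≤p : 1 ≤ p) (4p≤q : 4 * p ≤ q)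
                (deg : ∀ x → (q ∸ p) * n ≤ q * degB G x) (M : ℕ) (n-large : threshold r M ≤ n) where

  open Bicliques G
  open import Data.List.Membership.DecPropositional (Fin._≟_ {n}) using (_∈?_)

  noEdge? : ∀ x y → Dec (G x y ≡ nothing)
  noEdge? x y = nothing? (G x y)

  nonNeighbours : Fin a → List (Fin n)
  nonNeighbours x = filter (noEdge? x) (allFin n)

  length-nonNeighbours+degB : ∀ x → length (nonNeighbours x) + degB G x ≡ n
  length-nonNeighbours+degB x = trans (split (allFin n)) (length-tabulate id)
    where
    split : ∀ ys → length (filter (noEdge? x) ys)
                   + sum (map (λ y → if is-just (G x y) then 1 else 0) ys) ≡ length ys
    split [] = refl
    split (y ∷ ys) with G x y
    ... | nothing = cong suc (split ys)
    ... | just _  = trans (+-suc _ _) (cong suc (split ys))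

  q*nonNeighbours≤p*n : ∀ x → q * length (nonNeighbours x) ≤ p * n
  q*nonNeighbours≤p*n x = +-cancelʳ-≤ (q * degB G x) _ _ (begin
    q * length (nonNeighbours x) + q * degB G x  ≡⟨ *-distribˡ-+ q _ (degB G x) ⟨
    q * (length (nonNeighbours x) + degB G x)    ≡⟨ cong (q *_) (length-nonNeighbours+degB x) ⟩
    q * n                                        ≤⟨ m≤n+m∸n (q * n) (p * n) ⟩
    p * n + (q * n ∸ p * n)                      ≡⟨ cong (p * n +_) (*-distribʳ-∸ n q p) ⟨
    p * n + (q ∸ p) * n                          ≤⟨ +-monoʳ-≤ (p * n) (deg x) ⟩
    p * n + q * degB G x                         ∎)
    where open ≤-Reasoning

  nonNeighboursIn : List (Fin a) → Fin n → List (Fin a)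
  nonNeighboursIn xs y = filter (λ x → noEdge? x y) xs

  Good : List (Fin a) → Fin n → Set
  Good xs y = q * length (nonNeighboursIn xs y) ≤ 2 * p * length xs

  good? : ∀ xs y → Dec (Good xs y)
  good? xs y = q * length (nonNeighboursIn xs y) ≤? 2 * p * length xs

  few-bad : ∀ xs → 1 ≤ length xs → 2 * length (filter (∁? (good? xs)) (allFin n)) ≤ n
  few-bad xs 1≤s = *-cancelˡ-≤ (p * s) {{>-nonZero (*-mono-≤ 1≤p 1≤s)}} (begin
    p * s * (2 * length bad)                    ≡⟨ reorder p s (length bad) ⟩
    2 * p * s * length bad                      ≤⟨ markov (∁? (good? xs)) misses q (2 * p * s) bad⇒many (allFin n) ⟩
    q * sum (map misses (allFin n))             ≡⟨ cong (q *_) (double-counting noEdge? xs (allFin n)) ⟩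
    q * sum (map (length ∘ nonNeighbours) xs)   ≤⟨ sum-map-≤ _ q (p * n) xs (λ {x} _ → q*nonNeighbours≤p*n x) ⟩
    s * (p * n)                                 ≡⟨ reorder′ s p n ⟩
    p * s * n                                   ∎)
    where
    open ≤-Reasoning
    s = length xs
    bad = filter (∁? (good? xs)) (allFin n)
    misses = length ∘ nonNeighboursIn xs
    bad⇒many : ∀ {y} → ¬ Good xs y → 2 * p * s ≤ q * misses y
    bad⇒many ¬good = <⇒≤ (≰⇒> ¬good)
    reorder : ∀ p s b → p * s * (2 * b) ≡ 2 * p * s * b
    reorder = solve-∀
    reorder′ : ∀ s p n → s * (p * n) ≡ p * s * n
    reorder′ = solve-∀

  freshGood : List (Fin a) → List (Fin n) → List (Fin n)
  freshGood xs U = filter (∁? (_∈? U)) (filter (good? xs) (allFin n))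

  many-fresh-good : ∀ xs U → 1 ≤ length xs → length U ≤ 2 * M →
    refinementFactor r ^ M * M ≤ length (freshGood xs U)
  many-fresh-good xs U 1≤s U≤2M = +-cancelʳ-≤ (2 * M) _ _ (begin
    refinementFactor r ^ M * M + 2 * M   ≤⟨ *-cancelˡ-≤ 2 (≤-trans n-large n≤2*good) ⟩
    length good                          ≡⟨ length-filter-∁ (_∈? U) good ⟨
    length used + length fresh           ≤⟨ +-monoˡ-≤ (length fresh) (≤-trans used≤U U≤2M) ⟩
    2 * M + length fresh                 ≡⟨ +-comm (2 * M) _ ⟩
    length fresh + 2 * M                 ∎)
    where
    open ≤-Reasoning
    good = filter (good? xs) (allFin n)
    used = filter (_∈? U) good
    fresh = freshGood xs U
    n≤2*good : n ≤ 2 * length good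
    n≤2*good = m+n≡o⇒2n≤o⇒o≤2m (length good) _
      (trans (length-filter-∁ (good? xs) (allFin n)) (length-tabulate id)) (few-bad xs 1≤s)
    used≤U : length used ≤ length U
    used≤U = unique⇒length≤ (UP.filter⁺ (_∈? U) (UP.filter⁺ (good? xs) (UP.allFin⁺ n)))
                            (λ y∈ → proj₂ (∈-filter⁻ (_∈? U) {xs = good} y∈))

  record Round (xs : List (Fin a)) (U : List (Fin n)) : Set where
    field
      hub      : Fin n
      spokes   : List (Fin n)
      unique   : Unique spokes
      enough   : length xs ≤ length spokes
      fresh    : ∀ {y} → y ∈ spokes → y ∉ U
      uniform  : ∀ {x} → x ∈ xs → ∀ {y} → y ∈ spokes → G x y ≡ G x hub
      hub-good : Good xs hub

  round : ∀ xs U → 1 ≤ length xs → length U + 2 * length xs ≤ 2 * M → Round xs U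
  round xs U 1≤s budget = record
    { hub      = hub
    ; spokes   = Y
    ; unique   = unique-sublist Y⊆fresh (UP.filter⁺ (∁? (_∈? U)) (UP.filter⁺ (good? xs) (UP.allFin⁺ n)))
    ; enough   = s≤Y
    ; fresh    = λ y∈Y → proj₂ (∈-freshGood y∈Y)
    ; uniform  = λ x∈xs y∈Y → All.lookup uniformity x∈xs y∈Y hub∈Y
    ; hub-good = proj₂ (∈-filter⁻ (good? xs) {xs = allFin n} (proj₁ (∈-freshGood hub∈Y)))
    }
    where
    open ≤-Reasoning
    s = length xs
    F = refinementFactor r
    instance
      F≢0 : NonZero F
      F≢0 = m^n≢0 2 (length (edgeStates r))
    refined = homogeneous-sublist (≡-dec Fin._≟_) nothing (map just (allFin r)) ∈-edgeStates G
                                  xs (freshGood xs U)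
    Y = proj₁ refined
    Y⊆fresh = proj₁ (proj₂ refined)
    uniformity = proj₂ (proj₂ (proj₂ refined))
    ∈-freshGood : ∀ {y} → y ∈ Y → y ∈ filter (good? xs) (allFin n) × y ∉ U
    ∈-freshGood y∈Y = ∈-filter⁻ (∁? (_∈? U)) (Any-resp-⊆ Y⊆fresh y∈Y)
    s≤M : s ≤ M
    s≤M = *-cancelˡ-≤ 2 (m+n≤o⇒n≤o (length U) budget)
    s≤Y : s ≤ length Y
    s≤Y = *-cancelˡ-≤ (F ^ s) {{m^n≢0 F s}} (begin
      F ^ s * s                 ≤⟨ *-mono-≤ (^-monoʳ-≤ F s≤M) s≤M ⟩
      F ^ M * M                 ≤⟨ many-fresh-good xs U 1≤s (m+n≤o⇒m≤o (length U) budget) ⟩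
      length (freshGood xs U)   ≤⟨ proj₁ (proj₂ (proj₂ refined)) ⟩
      F ^ s * length Y          ∎)
    hub = proj₁ (∃∈ {xs = Y} (≤-trans 1≤s s≤Y))
    hub∈Y = proj₂ (∃∈ {xs = Y} (≤-trans 1≤s s≤Y))

  module RoundBicliques {xs : List (Fin a)} {U : List (Fin n)} (uxs : Unique xs) (R : Round xs U) where
    open Round R public

    matching : List (Fin a × Fin n)
    matching = zip xs spokes

    hubColour? : ∀ c (u : Fin a × Fin n) → Dec (G (proj₁ u) hub ≡ just c)
    hubColour? c u = ≡-dec Fin._≟_ (G (proj₁ u) hub) (just c)

    colourClass : Fin r → List (Fin a × Fin n)
    colourClass c = filter (hubColour? c) matching

    ∈-colourClass : ∀ {c u} → u ∈ colourClass c → u ∈ matching × G (proj₁ u) hub ≡ just c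
    ∈-colourClass {c} = ∈-filter⁻ (hubColour? c) {xs = matching}

    colourClass-complete : ∀ c {u v} → u ∈ colourClass c → v ∈ colourClass c →
      G (proj₁ u) (proj₂ v) ≡ just c
    colourClass-complete c {u} {v} u∈ v∈ = begin
      G (proj₁ u) (proj₂ v)   ≡⟨ uniform (proj₁ (∈-zip⁻ u∈matching)) (proj₂ (∈-zip⁻ v∈matching)) ⟩
      G (proj₁ u) hub         ≡⟨ u-c ⟩
      just c                  ∎
      where
      open ≡-Reasoning
      u∈matching = proj₁ (∈-colourClass u∈)
      v∈matching = proj₁ (∈-colourClass v∈)
      u-c = proj₂ (∈-colourClass u∈)

    class : Fin r → MonoBiclique
    class c = record
      { colour   = c
      ; pairs    = colourClass c
      ; apart    = APP.filter⁺ (hubColour? c) (zip-apart uxs unique)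
      ; complete = colourClass-complete c
      }

    classes : List MonoBiclique
    classes = tabulate class

    leftover : List (Fin a)
    leftover = nonNeighboursIn xs hub

    ∈-leftover : ∀ {x} → x ∈ leftover → x ∈ xs × G x hub ≡ nothing
    ∈-leftover = ∈-filter⁻ (λ x → noEdge? x hub) {xs = xs}

    used : List (Fin n)
    used = U ++ map proj₂ matching

    length-used : length used ≡ length U + length xs
    length-used = begin
      length (U ++ map proj₂ matching)        ≡⟨ length-++ U ⟩
      length U + length (map proj₂ matching)  ≡⟨ cong (length U +_) (length-map proj₂ matching) ⟩
      length U + length matching              ≡⟨ cong (length U +_) (length-zip {xs = xs} enough) ⟩
      length U + length xs                    ∎
      where open ≡-Reasoning

    classes-separated : AllPairs Separated classes
    classes-separated = APP.tabulate⁺ separated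
      where
      separated : ∀ {c c'} → c ≢ c' → Separated (class c) (class c')
      separated c≢c' {u} {v} u∈ v∈ = x-apart , y-apart
        where
        x-apart : proj₁ u ≢ proj₁ v
        x-apart refl = c≢c' (just-injective (trans (sym (proj₂ (∈-colourClass u∈))) (proj₂ (∈-colourClass v∈))))
        y-apart : proj₂ u ≢ proj₂ v
        y-apart y≡ with AllPairs-∈ (zip-apart uxs unique) (proj₁ (∈-colourClass u∈)) (proj₁ (∈-colourClass v∈))
        ... | inj₁ refl       = x-apart refl
        ... | inj₂ (inj₁ u#v) = proj₂ u#v y≡
        ... | inj₂ (inj₂ v#u) = proj₂ v#u (sym y≡)

    class-fits : ∀ c → FitsIn xs U (class c)
    class-fits c u∈ = let (x∈ , y∈) = ∈-zip⁻ (proj₁ (∈-colourClass u∈)) in x∈ , fresh y∈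

    fits-leftover⇒fits : ∀ {S} → FitsIn leftover used S → FitsIn xs U S
    fits-leftover⇒fits fits u∈ = proj₁ (∈-leftover (proj₁ (fits u∈))) , λ y∈U → proj₂ (fits u∈) (∈-++⁺ˡ y∈U)

    class-separated-from-leftover : ∀ c {S} → FitsIn leftover used S → Separated (class c) S
    class-separated-from-leftover c fits {u} {v} u∈ v∈ = x-apart , y-apart
      where
      x-apart : proj₁ u ≢ proj₁ v
      x-apart refl with trans (sym (proj₂ (∈-colourClass u∈))) (proj₂ (∈-leftover (proj₁ (fits v∈))))
      ... | ()
      y-apart : proj₂ u ≢ proj₂ v
      y-apart refl = proj₂ (fits v∈) (∈-++⁺ʳ U (∈-map⁺ proj₂ (proj₁ (∈-colourClass u∈))))

    covered : ∀ {x} → x ∈ xs → Any (Covers x) classes ⊎ x ∈ leftover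
    covered {x} x∈ with G x hub in eq
    ... | nothing = inj₂ (∈-filter⁺ (λ x → noEdge? x hub) x∈ eq)
    ... | just c  = let (y , xy∈) = ∈-zip⁺ enough x∈ in
                    inj₁ (AnyP.tabulate⁺ c (y , ∈-filter⁺ (hubColour? c) xy∈ eq))

    extend : ∀ {j} → Cover j leftover used → Cover (suc j) xs U
    extend {j} rest = record
      { bicliques = classes ++ bicliques
      ; few       = begin
          length (classes ++ bicliques)       ≡⟨ length-++ classes ⟩
          length classes + length bicliques   ≤⟨ +-mono-≤ (≤-reflexive (length-tabulate class)) few ⟩
          r + r * j                           ≡⟨ *-suc r j ⟨
          r * suc j                           ∎
      ; separated = APP.++⁺ classes-separated separated (AllP.tabulate⁺ classes-separated-from-rest)
      ; fit       = AllP.++⁺ (AllP.tabulate⁺ class-fits) (All.map (λ {S} → fits-leftover⇒fits {S}) fit)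
      ; covers    = λ x∈ → [ AnyP.++⁺ˡ , AnyP.++⁺ʳ classes ∘ covers ]′ (covered x∈)
      }
      where
      open ≤-Reasoning
      open Cover rest
      classes-separated-from-rest : ∀ c → All (Separated (class c)) bicliques
      classes-separated-from-rest c = All.map (λ {S} → class-separated-from-leftover c {S}) fit

  -- The budget |U| + 2|xs| ≤ 2M survives a round because |xs| at least halves;
  -- the potential |xs|(2δ)ʲ < 1 forces xs = [] at j = 0.
  cover : ∀ j xs U → Unique xs → length U + 2 * length xs ≤ 2 * M →
    length xs * (2 * p) ^ j < q ^ j → Cover j xs U
  cover j [] U _ _ _ = record { bicliques = [] ; few = z≤n ; separated = [] ; fit = [] ; covers = λ () }
  cover zero (_ ∷ _) U _ _ (s≤s ())
  cover (suc j) xs@(_ ∷ _) U uxs budget potential =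
    extend (cover j leftover used (UP.filter⁺ (λ x → noEdge? x hub) uxs) budget′ potential′)
    where
    open ≤-Reasoning
    open RoundBicliques uxs (round xs U (s≤s z≤n) budget)
    budget′ : length used + 2 * length leftover ≤ 2 * M
    budget′ = begin
      length used + 2 * length leftover          ≡⟨ cong (_+ 2 * length leftover) length-used ⟩
      length U + length xs + 2 * length leftover ≤⟨ +-monoʳ-≤ (length U + length xs) leftover-half ⟩
      length U + length xs + length xs           ≡⟨ reorder (length U) (length xs) ⟩
      length U + 2 * length xs                   ≤⟨ budget ⟩
      2 * M                                      ∎
      where
      leftover-half : 2 * length leftover ≤ length xs
      leftover-half = q*l≤2p*s⇒2*l≤s 1≤p 4p≤q hub-good
      reorder : ∀ u s → u + s + s ≡ u + 2 * s
      reorder = solve-∀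
    potential′ : length leftover * (2 * p) ^ j < q ^ j
    potential′ = q*l≤d*s⇒l*x<z {q} {length leftover} {2 * p} {length xs} hub-good potential

  cover-A : ∀ j → a ≤ M → a * (2 * p) ^ j < q ^ j → Cover j (allFin a) []
  cover-A j a≤M potential = cover j (allFin a) [] (UP.allFin⁺ a)
    (subst (λ l → 2 * l ≤ 2 * M) (sym |A|≡a) (*-monoʳ-≤ 2 a≤M))
    (subst (λ l → l * (2 * p) ^ j < q ^ j) (sym |A|≡a) potential)
    where
    |A|≡a : length (allFin a) ≡ a
    |A|≡a = length-tabulate id

lemma4p14 : (r K : ℕ) → 2 ≤ r → 2 ≤ K →
    ∃ λ n₀ → (n : ℕ) → n₀ ≤ n →
    -- δ = p / q with 0 < δ ≤ 1/4
    (p q : ℕ) → 1 ≤ p → 4 * p ≤ q →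
    (a : ℕ) → a ≤ r ^ (K * r) →
    (G : BipColGraph r a n) →
    -- deg(v,B) ≥ (1 - δ) n
    ((v : Fin a) → (q ∸ p) * n ≤ q * degB G v) →
    -- k ≥ 3Kr log r / log(1/δ), i.e. (1/δ)^k ≥ r^(3Kr)
    (k : ℕ) → r ^ (3 * K * r) * p ^ k ≤ q ^ k →
    Σ (List (MonoCycle G)) λ cs →
      length cs ≤ r * k ×
      AllPairs Disjoint cs ×
      ((x : Fin a) → Any (λ C → inj₁ x ∈C C) cs)
lemma4p14 r K 2≤r 2≤K = threshold r M , λ n n-large p q 1≤p 4p≤q a a≤M G deg k rᵏ≤ →
  let open Covering G p q 1≤p 4p≤q deg M n-large
      M³pᵏ≤qᵏ = subst (λ t → t * p ^ k ≤ q ^ k) r^[3Kr]≡M³ rᵏ≤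
      (cs , few , disjoint , covering) =
        Bicliques.cover⇒cycles G (cover-A k a≤M (a*[2p]^k<q^k {k = k} 2≤M a≤M 1≤p 4p≤q M³pᵏ≤qᵏ))
  in cs , few , disjoint , λ x → covering (∈-allFin x)
  where
  M = r ^ (K * r)
  2≤M : 2 ≤ M
  2≤M = begin
    2           ≤⟨ 2≤r ⟩
    r           ≡⟨ *-identityʳ r ⟨
    r ^ 1       ≤⟨ ^-monoʳ-≤ r {{>-nonZero (<⇒≤ 2≤r)}} (*-mono-≤ (<⇒≤ 2≤K) (<⇒≤ 2≤r)) ⟩
    r ^ (K * r) ∎
    where open ≤-Reasoning
  r^[3Kr]≡M³ : r ^ (3 * K * r) ≡ M * M * M
  r^[3Kr]≡M³ = trans (cong (r ^_) (*-assoc 3 K r)) (m^[3*e]≡m^e*m^e*m^e r (K * r))
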